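{- Let $M$ and $M'$ be two lists of nonzero vectors of $\mathbb{F}_2^r$, each generating $\mathbb{F}_2^r$, and for each $u\in\mathbb{F}_2^r\setminus\{0\}$ let $\mu_u$ and $\lambda_u$ denote the number of times $u$ occurs in $M$ and in $M'$ respectively. If $\mu_u\equiv\lambda_u \pmod 2$ for every $u\in\mathbb{F}_2^r\setminus\{0\}$, then $d(M)=d(M')$.
   Context: For a generating list $M=(v_1,\dots,v_n)$ of nonzero vectors of $\mathbb{F}_2^r$, $G(\mathbb{F}_2^r,M)$ is the Cayley multigraph with vertex set $\mathbb{F}_2^r$ and one edge between $w$ and $w+v_i$ for each vertex $w$ and each $i$. Its Laplacian $L(G)$ (degree $n$ on the diagonal, minus the number of edges between $u\neq v$ off the diagonal) satisfies $\operatorname{coker}L(G)\cong\mathbb{Z}\oplus K(G)$, with $K(G)$ the finite sandpile group. $d(M)$ denotes the number of invariant factors of $K(G)$ that are even, i.e. $d(M)=\dim_{\mathbb{F}_2}K(G)\otimes\mathbb{Z}/2\mathbb{Z}$. -}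

module Defs where

open import Data.Nat using (ℕ; zero; suc; _+_; _^_; _≤_; _%_)
open import Data.Nat.Divisibility using (_∣_)
open import Data.Nat.Properties using (+-identityʳ)
open import Data.Bool using (Bool; true; false; if_then_else_; _xor_)
open import Data.Fin using (Fin; toℕ; splitAt; cast) renaming (_≟_ to _≟ᶠ_)
open import Data.Vec using (Vec; []; _∷_; zipWith; replicate; foldr; lookup)
open import Data.Vec.Properties using (≡-dec)
import Data.Bool.Properties as BoolP
open import Data.Integer using (ℤ; +_; -_) renaming (_+_ to _+ℤ_; _*_ to _*ℤ_)
open import Data.Sum using (inj₁; inj₂)
open import Data.Product using (Σ; ∃; _×_)
open import Relation.Nullary using (Dec; yes; no; ¬_)
open import Relation.Binary.PropositionalEquality using (_≡_)

V : ℕ → Set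
V r = Vec Bool r

zeroV : ∀ r → V r
zeroV r = replicate r false

_⊕_ : ∀ {r} → V r → V r → V r
_⊕_ = zipWith _xor_

_≟V_ : ∀ {r} (u v : V r) → Dec (u ≡ v)
_≟V_ = ≡-dec BoolP._≟_

Nonzero : ∀ {r} → V r → Set
Nonzero {r} v = ¬ (v ≡ zeroV r)

linComb : ∀ {r n} → Vec (V r) n → Vec Bool n → V r
linComb {r} [] [] = zeroV r
linComb (v ∷ M) (b ∷ c) = (if b then v else zeroV _) ⊕ linComb M c

Generates : ∀ {r n} → Vec (V r) n → Set
Generates {r} M = ∀ (w : V r) → ∃ λ c → linComb M c ≡ w

mult : ∀ {r n} → V r → Vec (V r) n → ℕ
mult u [] = 0
mult u (v ∷ M) with u ≟V v
... | yes _ = suc (mult u M)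
... | no  _ = mult u M

-- Labelling of the vertices F₂^r by Fin (2 ^ r) (a fixed bijection,
-- binary expansion; first coordinate = most significant bit)

vecOf : ∀ r → Fin (2 ^ r) → V r
vecOf zero _ = []
vecOf (suc r) i with splitAt (2 ^ r) i
... | inj₁ j = false ∷ vecOf r j
... | inj₂ k = true ∷ vecOf r (cast (+-identityʳ (2 ^ r)) k)

Mat : ℕ → Set
Mat N = Fin N → Fin N → ℤ

sumFin : ∀ N → (Fin N → ℤ) → ℤ
sumFin zero f = + 0
sumFin (suc N) f = f Data.Fin.zero +ℤ sumFin N (λ i → f (Data.Fin.suc i))

_⊗_ : ∀ {N} → Mat N → Mat N → Mat N
_⊗_ {N} A B i j = sumFin N (λ k → A i k *ℤ B k j)

idMat : ∀ {N} → Mat N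
idMat i j with i ≟ᶠ j
... | yes _ = + 1
... | no  _ = + 0

diagMat : ∀ {N} → (Fin N → ℕ) → Mat N
diagMat s i j with i ≟ᶠ j
... | yes _ = + (s i)
... | no  _ = + 0

-- number of edges between vertices a ≠ b : #{ k : a + v_k = b }
edges : ∀ {r n} → Vec (V r) n → V r → V r → ℕ
edges [] a b = 0
edges (v ∷ M) a b with (a ⊕ v) ≟V b
... | yes _ = suc (edges M a b)
... | no  _ = edges M a b

laplacian : ∀ {r n} → Vec (V r) n → Mat (2 ^ r)
laplacian {r} {n} M i j with i ≟ᶠ j
... | yes _ = + n
... | no  _ = - (+ edges M (vecOf r i) (vecOf r j))

record SmithForm {N : ℕ} (L : Mat N) : Set where
  field
    P P⁻¹ Q Q⁻¹ : Mat N
    PP⁻¹ : ∀ i j → (P ⊗ P⁻¹) i j ≡ idMat i j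
    P⁻¹P : ∀ i j → (P⁻¹ ⊗ P) i j ≡ idMat i j
    QQ⁻¹ : ∀ i j → (Q ⊗ Q⁻¹) i j ≡ idMat i j
    Q⁻¹Q : ∀ i j → (Q⁻¹ ⊗ Q) i j ≡ idMat i j
    s : Fin N → ℕ
    chain : ∀ i j → toℕ i ≤ toℕ j → s i ∣ s j
    diagonal : ∀ i j → ((P ⊗ L) ⊗ Q) i j ≡ diagMat s i j

-- Since
-- coker L ≅ ⊕ᵢ ℤ/sᵢ, the zero entries give the free part ℤ and the
-- nonzero sᵢ ≠ 1 are the invariant factors of K(G); so this is the
-- number of even invariant factors of K(G).
evenNonzero : ∀ {N} → (Fin N → ℕ) → ℕ
evenNonzero {zero} s = 0
evenNonzero {suc N} s with s Data.Fin.zero | s Data.Fin.zero % 2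
... | zero  | _     = evenNonzero (λ i → s (Data.Fin.suc i))
... | suc _ | zero  = suc (evenNonzero (λ i → s (Data.Fin.suc i)))
... | suc _ | suc _ = evenNonzero (λ i → s (Data.Fin.suc i))

dOf : ∀ {N} {L : Mat N} → SmithForm L → ℕ
dOf S = evenNonzero (SmithForm.s S)

{-# OPTIONS --safe #-}
-- Write a Smith form of the Laplacian L = L(G(F₂^r, M)) as P L Q = diag(s). Over ℤ, the
-- kernel of L consists of the constant vectors (a maximum principle on the connected graph
-- G), which forces exactly one sᵢ to vanish; so d(M) = #{i : sᵢ even} - 1. Reducing modulo
-- 2, P L Q = diag(s) remains an equivalence over F₂, hence #{i : sᵢ even} is the F₂-nullity
-- of L mod 2. Finally L mod 2 depends only on the multiplicities mod 2: off the diagonal it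
-- records them, and the diagonal is then determined because the rows of L sum to zero.
module Submission where

open import Defs
open import Data.Nat using (ℕ; _%_)
open import Data.Vec using (Vec)
open import Data.Vec.Relation.Unary.All using (All)
open import Relation.Binary.PropositionalEquality using (_≡_)

open import Algebra.Bundles using (CommutativeRing)
open import Data.Bool using (Bool; true; false)
import Data.Bool.Properties as Bool
open import Data.Fin using (Fin; zero; suc; punchIn; splitAt; join; cast)
import Data.Fin.Properties as Finₚ
open import Data.Integer as ℤ using (ℤ; +_; -[1+_]; ∣_∣; _⊖_)
import Data.Integer.Properties as ℤ
open import Data.List using (allFin)
open import Data.List.Extrema ℤ.≤-totalOrder using (argmax; f[xs]≤f[argmax])
open import Data.List.Membership.Propositional.Properties using (∈-allFin)
import Data.List.Relation.Unary.All as ListAll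
open import Data.Nat as ℕ using (_^_; _≤_; z≤n; s≤s; parity)
open import Data.Nat.DivMod using (m%n<n)
import Data.Nat.Properties as ℕ
open import Data.Parity as ℙ using (Parity; 0ℙ; 1ℙ)
import Data.Parity.Properties as ℙ
open import Data.Product using (∃; _×_; _,_; proj₁; proj₂)
open import Data.Sum using (inj₁; inj₂)
open import Data.Vec using ([]; _∷_; lookup; count; tabulate)
open import Data.Vec.Functional using (Vector) renaming (_∷_ to _◂_)
open import Data.Vec.Properties using (zipWith-assoc; zipWith-identityˡ; zipWith-identityʳ)
open import Data.Vec.Relation.Unary.All using ([]; _∷_)
open import Function using (_∘_)
open import Function.Definitions using (Injective)
open import Level using (_⊔_)
open import Relation.Binary.PropositionalEquality
  using (_≢_; refl; sym; trans; cong; cong₂; subst; module ≡-Reasoning)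
open import Relation.Nullary using (¬_; yes; no; contradiction)
open import Relation.Unary using (Pred; Decidable)

-- Matrices over a commutative ring

module MatrixAlgebra {c ℓ} (R : CommutativeRing c ℓ) where

  open CommutativeRing R hiding (zero) renaming (sym to ≈-sym; trans to ≈-trans)
  open import Algebra.Properties.Semiring.Sum semiring public using (sum; sum-syntax; sum-cong-≋)
  open import Algebra.Properties.Semiring.Sum semiring
    using (sum-replicate-zero; sum-remove; ∑-distrib-+; ∑-comm; *-distribˡ-sum; *-distribʳ-sum)
  open import Algebra.Properties.CommutativeSemigroup *-commutativeSemigroup using (x∙yz≈y∙xz)
  open import Algebra.Properties.Group +-group using (∙-cancelʳ)
  open import Algebra.Properties.Ring ring using (-‿distribˡ-*; -1*x≈-x)
  open import Data.Vec.Functional.Relation.Binary.Equality.Setoid setoid public using (_≋_)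
  open import Relation.Binary.Reasoning.Setoid setoid

  private variable N : ℕ

  Matrix : ℕ → Set c
  Matrix N = Fin N → Fin N → Carrier

  infixl 7 _*ᴹ_ _⊙_
  infixr 6 _·_

  _*ᴹ_ : Matrix N → Matrix N → Matrix N
  _*ᴹ_ {N} A B i j = ∑[ k < N ] (A i k * B k j)

  _·_ : Matrix N → Vector Carrier N → Vector Carrier N
  _·_ {N} A x i = ∑[ k < N ] (A i k * x k)

  _⊙_ : Vector Carrier N → Vector Carrier N → Vector Carrier N
  (d ⊙ x) i = d i * x i

  0ᵛ 1ᵛ : Vector Carrier N
  0ᵛ _ = 0#
  1ᵛ _ = 1#

  IsDiagonal : Vector Carrier N → Matrix N → Set ℓ
  IsDiagonal d A = (∀ i → A i i ≈ d i) × (∀ {i j} → i ≢ j → A i j ≈ 0#)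

  IsIdentity : Matrix N → Set ℓ
  IsIdentity = IsDiagonal 1ᵛ

  IsDiagonal-resp : ∀ {d} {A B : Matrix N} → (∀ i j → A i j ≈ B i j) → IsDiagonal d B → IsDiagonal d A
  IsDiagonal-resp A≈B (Bᵢᵢ≈dᵢ , Bᵢⱼ≈0) =
    (λ i → ≈-trans (A≈B i i) (Bᵢᵢ≈dᵢ i)) , (λ i≢j → ≈-trans (A≈B _ _) (Bᵢⱼ≈0 i≢j))

  ∑-zero : (f : Vector Carrier N) → f ≋ 0ᵛ → ∑[ j < N ] f j ≈ 0#
  ∑-zero {N} f f≋0 = ≈-trans (sum-cong-≋ f≋0) (sum-replicate-zero N)

  ∑-single : (f : Vector Carrier N) (t : Fin N) → (∀ {j} → j ≢ t → f j ≈ 0#) → ∑[ j < N ] f j ≈ f t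
  ∑-single f zero f≈0 = begin
    f zero + ∑[ j < _ ] f (suc j)  ≈⟨ +-congˡ (∑-zero (f ∘ suc) (λ j → f≈0 λ ())) ⟩
    f zero + 0#                    ≈⟨ +-identityʳ _ ⟩
    f zero                         ∎
  ∑-single f (suc t) f≈0 = begin
    f zero + ∑[ j < _ ] f (suc j)
      ≈⟨ +-cong (f≈0 λ ()) (∑-single (f ∘ suc) t (λ j≢t → f≈0 (j≢t ∘ Finₚ.suc-injective))) ⟩
    0# + f (suc t)                 ≈⟨ +-identityˡ _ ⟩
    f (suc t)                      ∎

  ·-cong : (A : Matrix N) {x y : Vector Carrier N} → x ≋ y → A · x ≋ A · y
  ·-cong A x≋y i = sum-cong-≋ (λ k → *-congˡ (x≋y k))

  ·-congˡ : {A B : Matrix N} → (∀ i j → A i j ≈ B i j) → ∀ x → A · x ≋ B · x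
  ·-congˡ A≈B x i = sum-cong-≋ (λ k → *-congʳ (A≈B i k))

  *ᴹ-· : (A B : Matrix N) (x : Vector Carrier N) → (A *ᴹ B) · x ≋ A · B · x
  *ᴹ-· {N} A B x i = begin
    ∑[ k < N ] ((∑[ l < N ] (A i l * B l k)) * x k)
      ≈⟨ sum-cong-≋ (λ k → *-distribʳ-sum (x k) (λ l → A i l * B l k)) ⟩
    ∑[ k < N ] ∑[ l < N ] (A i l * B l k * x k)
      ≈⟨ sum-cong-≋ (λ k → sum-cong-≋ (λ l → *-assoc (A i l) (B l k) (x k))) ⟩
    ∑[ k < N ] ∑[ l < N ] (A i l * (B l k * x k))
      ≈⟨ ∑-comm (λ k l → A i l * (B l k * x k)) ⟩
    ∑[ l < N ] ∑[ k < N ] (A i l * (B l k * x k))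
      ≈⟨ sum-cong-≋ (λ l → *-distribˡ-sum (A i l) (λ k → B l k * x k)) ⟨
    ∑[ l < N ] (A i l * (B · x) l)
      ∎

  ·-zeroʳ : (A : Matrix N) → A · 0ᵛ ≋ 0ᵛ
  ·-zeroʳ A i = ∑-zero _ (λ k → zeroʳ (A i k))

  ·-*ₗ : (A : Matrix N) (a : Carrier) (x : Vector Carrier N) → A · (λ k → a * x k) ≋ (λ i → a * (A · x) i)
  ·-*ₗ {N} A a x i = begin
    ∑[ k < N ] (A i k * (a * x k))  ≈⟨ sum-cong-≋ (λ k → x∙yz≈y∙xz (A i k) a (x k)) ⟩
    ∑[ k < N ] (a * (A i k * x k))  ≈⟨ *-distribˡ-sum a (λ k → A i k * x k) ⟨
    a * (A · x) i                   ∎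

  ·-distribʳ-+ : (A B : Matrix N) (x : Vector Carrier N) → (λ i j → A i j + B i j) · x ≋ (λ i → (A · x) i + (B · x) i)
  ·-distribʳ-+ A B x i =
    ≈-trans (sum-cong-≋ (λ k → distribʳ (x k) (A i k) (B i k))) (∑-distrib-+ (λ k → A i k * x k) (λ k → B i k * x k))

  ·-neg : (A : Matrix N) (x : Vector Carrier N) → (λ i j → - A i j) · x ≋ (λ i → - (A · x) i)
  ·-neg {N} A x i = begin
    ∑[ k < N ] (- A i k * x k)
      ≈⟨ sum-cong-≋ (λ k → ≈-trans (≈-sym (-‿distribˡ-* (A i k) (x k))) (≈-sym (-1*x≈-x _))) ⟩
    ∑[ k < N ] (- 1# * (A i k * x k))  ≈⟨ *-distribˡ-sum (- 1#) (λ k → A i k * x k) ⟨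
    - 1# * (A · x) i                   ≈⟨ -1*x≈-x _ ⟩
    - (A · x) i                        ∎

  ·-diagonal : {d : Vector Carrier N} {A : Matrix N} → IsDiagonal d A → ∀ x → A · x ≋ d ⊙ x
  ·-diagonal {d = d} {A} (Aᵢᵢ≈dᵢ , Aᵢⱼ≈0) x i = begin
    (A · x) i
      ≈⟨ ∑-single (λ k → A i k * x k) i (λ k≢i → ≈-trans (*-congʳ (Aᵢⱼ≈0 (k≢i ∘ sym))) (zeroˡ _)) ⟩
    A i i * x i  ≈⟨ *-congʳ (Aᵢᵢ≈dᵢ i) ⟩
    (d ⊙ x) i    ∎

  ·-identity : {A : Matrix N} → IsIdentity A → ∀ x → A · x ≋ x
  ·-identity A≈I x i = ≈-trans (·-diagonal A≈I x i) (*-identityˡ (x i))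

  ·-inverse : (A B : Matrix N) → IsIdentity (A *ᴹ B) → ∀ x → A · B · x ≋ x
  ·-inverse A B AB≈I x i = ≈-trans (≈-sym (*ᴹ-· A B x i)) (·-identity AB≈I x i)

  offDiagonal-determines : (A B : Matrix N) → A · 1ᵛ ≋ 0ᵛ → B · 1ᵛ ≋ 0ᵛ →
                           (∀ {i j} → i ≢ j → A i j ≈ B i j) → ∀ i j → A i j ≈ B i j
  offDiagonal-determines {ℕ.suc N} A B A1≋0 B1≋0 A≈B i j with i Data.Fin.≟ j
  ... | no  i≢j = A≈B i≢j
  ... | yes refl = ∙-cancelʳ (rest A) (A i i) (B i i) (begin
    A i i + rest A       ≈⟨ +-congʳ (*-identityʳ (A i i)) ⟨
    A i i * 1# + rest A  ≈⟨ sum-remove (λ k → A i k * 1#) ⟨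
    (A · 1ᵛ) i           ≈⟨ ≈-trans (A1≋0 i) (≈-sym (B1≋0 i)) ⟩
    (B · 1ᵛ) i           ≈⟨ sum-remove (λ k → B i k * 1#) ⟩
    B i i * 1# + rest B
      ≈⟨ +-cong (*-identityʳ (B i i)) (sum-cong-≋ λ k → *-congʳ (≈-sym (A≈B (Finₚ.punchInᵢ≢i i k ∘ sym)))) ⟩
    B i i + rest A       ∎)
    where
    rest : Matrix (ℕ.suc N) → Carrier
    rest C = ∑[ k < N ] (C i (punchIn i k) * 1#)

  record Diagonalisation {N} (L : Matrix N) (d : Vector Carrier N) : Set (c ⊔ ℓ) where
    field
      P P⁻¹ Q Q⁻¹ : Matrix N
      P⁻¹·P : ∀ x → P⁻¹ · P · x ≋ x
      Q·Q⁻¹ : ∀ x → Q · Q⁻¹ · x ≋ x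
      Q⁻¹·Q : ∀ x → Q⁻¹ · Q · x ≋ x
      P·L·Q : ∀ x → P · L · Q · x ≋ d ⊙ x

    kernel-sound : ∀ {x} → d ⊙ x ≋ 0ᵛ → L · Q · x ≋ 0ᵛ
    kernel-sound {x} dx≋0 i = begin
      (L · Q · x) i            ≈⟨ P⁻¹·P (L · Q · x) i ⟨
      (P⁻¹ · P · L · Q · x) i  ≈⟨ ·-cong P⁻¹ (λ k → ≈-trans (P·L·Q x k) (dx≋0 k)) i ⟩
      (P⁻¹ · 0ᵛ) i             ≈⟨ ·-zeroʳ P⁻¹ i ⟩
      0#                       ∎

    kernel-complete : ∀ {y} → L · y ≋ 0ᵛ → d ⊙ (Q⁻¹ · y) ≋ 0ᵛ
    kernel-complete {y} Ly≋0 i = begin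
      d i * (Q⁻¹ · y) i        ≈⟨ P·L·Q (Q⁻¹ · y) i ⟨
      (P · L · Q · Q⁻¹ · y) i  ≈⟨ ·-cong P (·-cong L (Q·Q⁻¹ y)) i ⟩
      (P · L · y) i            ≈⟨ ·-cong P Ly≋0 i ⟩
      (P · 0ᵛ) i               ≈⟨ ·-zeroʳ P i ⟩
      0#                       ∎

  Diagonalisation-resp : ∀ {L L′ : Matrix N} {d} → (∀ i j → L i j ≈ L′ i j) →
                         Diagonalisation L d → Diagonalisation L′ d
  Diagonalisation-resp L≈L′ D = record
    { Diagonalisation D
    ; P·L·Q = λ x i → ≈-trans (·-cong P (·-congˡ (λ i j → ≈-sym (L≈L′ i j)) (Q · x)) i) (P·L·Q x i)
    }
    where open Diagonalisation D

  fromMatrixIdentities : ∀ {L : Matrix N} {d} (P P⁻¹ Q Q⁻¹ : Matrix N) →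
    IsIdentity (P⁻¹ *ᴹ P) → IsIdentity (Q *ᴹ Q⁻¹) → IsIdentity (Q⁻¹ *ᴹ Q) →
    IsDiagonal d (P *ᴹ L *ᴹ Q) → Diagonalisation L d
  fromMatrixIdentities {L = L} {d} P P⁻¹ Q Q⁻¹ P⁻¹P≈I QQ⁻¹≈I Q⁻¹Q≈I PLQ≈D = record
    { P = P ; P⁻¹ = P⁻¹ ; Q = Q ; Q⁻¹ = Q⁻¹
    ; P⁻¹·P = ·-inverse P⁻¹ P P⁻¹P≈I
    ; Q·Q⁻¹ = ·-inverse Q Q⁻¹ QQ⁻¹≈I
    ; Q⁻¹·Q = ·-inverse Q⁻¹ Q Q⁻¹Q≈I
    ; P·L·Q = λ x i → begin
        (P · L · Q · x) i      ≈⟨ *ᴹ-· P L (Q · x) i ⟨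
        ((P *ᴹ L) · Q · x) i   ≈⟨ *ᴹ-· (P *ᴹ L) Q x i ⟨
        ((P *ᴹ L *ᴹ Q) · x) i  ≈⟨ ·-diagonal PLQ≈D x i ⟩
        (d ⊙ x) i              ∎
    }

-- The vector space F₂^r

⊕-assoc : ∀ {r} (u v w : V r) → (u ⊕ v) ⊕ w ≡ u ⊕ (v ⊕ w)
⊕-assoc = zipWith-assoc Bool.xor-assoc

⊕-identityʳ : ∀ {r} (u : V r) → u ⊕ zeroV r ≡ u
⊕-identityʳ = zipWith-identityʳ Bool.xor-identityʳ

⊕-self : ∀ {r} (u : V r) → u ⊕ u ≡ zeroV r
⊕-self []      = refl
⊕-self (b ∷ u) = cong₂ _∷_ (Bool.xor-same b) (⊕-self u)

⊕-cancelˡ : ∀ {r} (u v : V r) → u ⊕ (u ⊕ v) ≡ v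
⊕-cancelˡ {r} u v = begin
  u ⊕ (u ⊕ v)  ≡⟨ ⊕-assoc u u v ⟨
  (u ⊕ u) ⊕ v  ≡⟨ cong (_⊕ v) (⊕-self u) ⟩
  zeroV r ⊕ v  ≡⟨ zipWith-identityˡ Bool.xor-identityˡ v ⟩
  v            ∎
  where open ≡-Reasoning

indexOf : ∀ r → V r → Fin (2 ^ r)
indexOf ℕ.zero    []          = zero
indexOf (ℕ.suc r) (false ∷ w) = join (2 ^ r) (2 ^ r ℕ.+ 0) (inj₁ (indexOf r w))
indexOf (ℕ.suc r) (true ∷ w)  = join (2 ^ r) (2 ^ r ℕ.+ 0) (inj₂ (cast (sym (ℕ.+-identityʳ (2 ^ r))) (indexOf r w)))

vecOf-indexOf : ∀ r w → vecOf r (indexOf r w) ≡ w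
vecOf-indexOf ℕ.zero [] = refl
vecOf-indexOf (ℕ.suc r) (false ∷ w)
  rewrite Finₚ.splitAt-↑ˡ (2 ^ r) (indexOf r w) (2 ^ r ℕ.+ 0) = cong (false ∷_) (vecOf-indexOf r w)
vecOf-indexOf (ℕ.suc r) (true ∷ w)
  rewrite Finₚ.splitAt-↑ʳ (2 ^ r) (2 ^ r ℕ.+ 0) (cast (sym (ℕ.+-identityʳ (2 ^ r))) (indexOf r w))
        | Finₚ.cast-involutive (ℕ.+-identityʳ (2 ^ r)) (sym (ℕ.+-identityʳ (2 ^ r))) (indexOf r w)
  = cong (true ∷_) (vecOf-indexOf r w)

indexOf-vecOf : ∀ r i → indexOf r (vecOf r i) ≡ i
indexOf-vecOf ℕ.zero zero = refl
indexOf-vecOf (ℕ.suc r) i with splitAt (2 ^ r) i in eq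
... | inj₁ j rewrite indexOf-vecOf r j
  = trans (cong (join (2 ^ r) (2 ^ r ℕ.+ 0)) (sym eq)) (Finₚ.join-splitAt (2 ^ r) (2 ^ r ℕ.+ 0) i)
... | inj₂ k rewrite indexOf-vecOf r (cast (ℕ.+-identityʳ (2 ^ r)) k)
                   | Finₚ.cast-involutive (sym (ℕ.+-identityʳ (2 ^ r))) (ℕ.+-identityʳ (2 ^ r)) k
  = trans (cong (join (2 ^ r) (2 ^ r ℕ.+ 0)) (sym eq)) (Finₚ.join-splitAt (2 ^ r) (2 ^ r ℕ.+ 0) i)

indexOf-injective : ∀ r → Injective _≡_ _≡_ (indexOf r)
indexOf-injective r {u} {w} eq = trans (sym (vecOf-indexOf r u)) (trans (cong (vecOf r) eq) (vecOf-indexOf r w))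

vecOf-injective : ∀ r → Injective _≡_ _≡_ (vecOf r)
vecOf-injective r {i} {j} eq = trans (sym (indexOf-vecOf r i)) (trans (cong (indexOf r) eq) (indexOf-vecOf r j))

Vec-injective⇒≤ : ∀ {m n} {f : Vec Bool m → Vec Bool n} → Injective _≡_ _≡_ f → m ≤ n
Vec-injective⇒≤ {m} {n} f-injective = ℕ.≮⇒≥ λ n<m →
  ℕ.<⇒≱ (ℕ.^-monoʳ-< 2 (s≤s (s≤s z≤n)) n<m)
        (Finₚ.injective⇒≤ (vecOf-injective m ∘ f-injective ∘ indexOf-injective n))

-- Reduction modulo 2

parityℤ : ℤ → Parity
parityℤ i = parity ∣ i ∣

parity-%2 : ∀ n → parity (n % 2) ≡ parity n
parity-%2 ℕ.zero            = refl
parity-%2 (ℕ.suc ℕ.zero)    = refl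
parity-%2 (ℕ.suc (ℕ.suc n)) = parity-%2 n

parity-suc+suc : ∀ m n → parity (ℕ.suc m) ℙ.+ parity (ℕ.suc n) ≡ parity m ℙ.+ parity n
parity-suc+suc m n = begin
  parity (ℕ.suc m) ℙ.+ parity (ℕ.suc n)  ≡⟨ ℙ.+-homo-+ (ℕ.suc m) (ℕ.suc n) ⟨
  parity (ℕ.suc (m ℕ.+ ℕ.suc n))         ≡⟨ cong (parity ∘ ℕ.suc) (ℕ.+-suc m n) ⟩
  parity (m ℕ.+ n)                       ≡⟨ ℙ.+-homo-+ m n ⟩
  parity m ℙ.+ parity n                  ∎
  where open ≡-Reasoning

parityℤ-⊖ : ∀ m n → parityℤ (m ⊖ n) ≡ parity m ℙ.+ parity n
parityℤ-⊖ ℕ.zero    ℕ.zero    = refl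
parityℤ-⊖ ℕ.zero    (ℕ.suc n) = refl
parityℤ-⊖ (ℕ.suc m) ℕ.zero    = sym (ℙ.+-identityʳ _)
parityℤ-⊖ (ℕ.suc m) (ℕ.suc n) = begin
  parityℤ (ℕ.suc m ⊖ ℕ.suc n)            ≡⟨ cong parityℤ (ℤ.[1+m]⊖[1+n]≡m⊖n m n) ⟩
  parityℤ (m ⊖ n)                        ≡⟨ parityℤ-⊖ m n ⟩
  parity m ℙ.+ parity n                  ≡⟨ parity-suc+suc m n ⟨
  parity (ℕ.suc m) ℙ.+ parity (ℕ.suc n)  ∎
  where open ≡-Reasoning

parityℤ-+ : ∀ i j → parityℤ (i ℤ.+ j) ≡ parityℤ i ℙ.+ parityℤ j
parityℤ-+ (+ m)    (+ n)    = ℙ.+-homo-+ m n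
parityℤ-+ (+ m)    -[1+ n ] = parityℤ-⊖ m (ℕ.suc n)
parityℤ-+ -[1+ m ] (+ n)    = trans (parityℤ-⊖ n (ℕ.suc m)) (ℙ.+-comm (parity n) _)
parityℤ-+ -[1+ m ] -[1+ n ] = trans (ℙ.+-homo-+ m n) (sym (parity-suc+suc m n))

parityℤ-* : ∀ i j → parityℤ (i ℤ.* j) ≡ parityℤ i ℙ.* parityℤ j
parityℤ-* i j = trans (cong parity (ℤ.abs-* i j)) (ℙ.*-homo-* ∣ i ∣ ∣ j ∣)

parityℤ-neg : ∀ i → parityℤ (ℤ.- i) ≡ parityℤ i
parityℤ-neg i = cong parity (ℤ.∣-i∣≡∣i∣ i)

module ℤᴹ = MatrixAlgebra ℤ.+-*-commutativeRing
module ℙᴹ = MatrixAlgebra ℙ.+-*-commutativeRing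

parityℤ-∑ : ∀ {N} (f : Vector ℤ N) → parityℤ (ℤᴹ.sum f) ≡ ℙᴹ.sum (parityℤ ∘ f)
parityℤ-∑ {ℕ.zero}  f = refl
parityℤ-∑ {ℕ.suc N} f = trans (parityℤ-+ (f zero) _) (cong (parityℤ (f zero) ℙ.+_) (parityℤ-∑ (f ∘ suc)))

parityᴹ : ∀ {N} → ℤᴹ.Matrix N → ℙᴹ.Matrix N
parityᴹ A i j = parityℤ (A i j)

parityℤ-· : ∀ {N} (A : ℤᴹ.Matrix N) (x : Vector ℤ N) i →
            parityℤ ((A ℤᴹ.· x) i) ≡ (parityᴹ A ℙᴹ.· (parityℤ ∘ x)) i
parityℤ-· A x i = trans (parityℤ-∑ (λ k → A i k ℤ.* x k)) (ℙᴹ.sum-cong-≋ (λ k → parityℤ-* (A i k) (x k)))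

parityᴹ-*ᴹ : ∀ {N} (A B : ℤᴹ.Matrix N) i j → parityᴹ (A ℤᴹ.*ᴹ B) i j ≡ (parityᴹ A ℙᴹ.*ᴹ parityᴹ B) i j
parityᴹ-*ᴹ A B i j = parityℤ-· A (λ k → B k j) i

parityᴹ-isDiagonal : ∀ {N} {d : Vector ℤ N} {A} →
                     ℤᴹ.IsDiagonal d A → ℙᴹ.IsDiagonal (parityℤ ∘ d) (parityᴹ A)
parityᴹ-isDiagonal (Aᵢᵢ≡dᵢ , Aᵢⱼ≡0) = cong parityℤ ∘ Aᵢᵢ≡dᵢ , λ i≢j → cong parityℤ (Aᵢⱼ≡0 i≢j)

-- Smith forms as diagonalisations

sumFin≡∑ : ∀ N (f : Vector ℤ N) → sumFin N f ≡ ℤᴹ.sum f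
sumFin≡∑ ℕ.zero    f = refl
sumFin≡∑ (ℕ.suc N) f = cong (λ t → f zero ℤ.+ t) (sumFin≡∑ N (f ∘ suc))

⊗≡*ᴹ : ∀ {N} (A B : Mat N) i j → (A ⊗ B) i j ≡ (A ℤᴹ.*ᴹ B) i j
⊗≡*ᴹ {N} A B i j = sumFin≡∑ N (λ k → A i k ℤ.* B k j)

diagMat-isDiagonal : ∀ {N} (s : Fin N → ℕ) → ℤᴹ.IsDiagonal (λ i → + s i) (diagMat s)
diagMat-isDiagonal s = diagonal , offDiagonal
  where
  diagonal : ∀ i → diagMat s i i ≡ + s i
  diagonal i with i Data.Fin.≟ i
  ... | yes _   = refl
  ... | no  i≢i = contradiction refl i≢i
  offDiagonal : ∀ {i j} → i ≢ j → diagMat s i j ≡ + 0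
  offDiagonal {i} {j} i≢j with i Data.Fin.≟ j
  ... | yes i≡j = contradiction i≡j i≢j
  ... | no  _   = refl

idMat≡diagMat : ∀ {N} (i j : Fin N) → idMat i j ≡ diagMat (λ _ → 1) i j
idMat≡diagMat i j with i Data.Fin.≟ j
... | yes _ = refl
... | no  _ = refl

idMat-isIdentity : ∀ {N} → ℤᴹ.IsIdentity (idMat {N})
idMat-isIdentity = ℤᴹ.IsDiagonal-resp idMat≡diagMat (diagMat-isDiagonal (λ _ → 1))

module FromSmithForm {N} {L : Mat N} (S : SmithForm L) where
  open SmithForm S

  private
    isIdentity : (A B : Mat N) → (∀ i j → (A ⊗ B) i j ≡ idMat i j) → ℤᴹ.IsIdentity (A ℤᴹ.*ᴹ B)
    isIdentity A B AB≡I = ℤᴹ.IsDiagonal-resp (λ i j → trans (sym (⊗≡*ᴹ A B i j)) (AB≡I i j)) idMat-isIdentity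

    PLQ-isDiagonal : ℤᴹ.IsDiagonal (λ i → + s i) (P ℤᴹ.*ᴹ L ℤᴹ.*ᴹ Q)
    PLQ-isDiagonal = ℤᴹ.IsDiagonal-resp
      (λ i j → trans (ℤᴹ.sum-cong-≋ (λ k → cong (ℤ._* Q k j) (sym (⊗≡*ᴹ P L i k))))
                     (trans (sym (⊗≡*ᴹ (P ⊗ L) Q i j)) (diagonal i j)))
      (diagMat-isDiagonal s)

    mod2 : ∀ {d} (A B : Mat N) →
           ℤᴹ.IsDiagonal d (A ℤᴹ.*ᴹ B) → ℙᴹ.IsDiagonal (parityℤ ∘ d) (parityᴹ A ℙᴹ.*ᴹ parityᴹ B)
    mod2 A B = ℙᴹ.IsDiagonal-resp (λ i j → sym (parityᴹ-*ᴹ A B i j)) ∘ parityᴹ-isDiagonal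

  overℤ : ℤᴹ.Diagonalisation L (λ i → + s i)
  overℤ = ℤᴹ.fromMatrixIdentities P P⁻¹ Q Q⁻¹
    (isIdentity P⁻¹ P P⁻¹P) (isIdentity Q Q⁻¹ QQ⁻¹) (isIdentity Q⁻¹ Q Q⁻¹Q) PLQ-isDiagonal

  overℙ : ℙᴹ.Diagonalisation (parityᴹ L) (λ i → parity (s i))
  overℙ = ℙᴹ.fromMatrixIdentities (parityᴹ P) (parityᴹ P⁻¹) (parityᴹ Q) (parityᴹ Q⁻¹)
    (mod2 P⁻¹ P (isIdentity P⁻¹ P P⁻¹P))
    (mod2 Q Q⁻¹ (isIdentity Q Q⁻¹ QQ⁻¹))
    (mod2 Q⁻¹ Q (isIdentity Q⁻¹ Q Q⁻¹Q))
    (ℙᴹ.IsDiagonal-resp (λ i j → ℙᴹ.sum-cong-≋ (λ k → cong (ℙ._* parityᴹ Q k j) (sym (parityᴹ-*ᴹ P L i k))))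
      (mod2 (P ℤᴹ.*ᴹ L) Q PLQ-isDiagonal))

open FromSmithForm using (overℤ; overℙ)

-- Nullity over F₂

nullity : ∀ {N} → Vector Parity N → ℕ
nullity d = count (ℙ._≟ 0ℙ) (tabulate d)

zeroCount : ∀ {N} → (Fin N → ℕ) → ℕ
zeroCount s = count (ℕ._≟ 0) (tabulate s)

nullity-parity : ∀ {N} (s : Fin N → ℕ) → nullity (λ i → parity (s i)) ≡ zeroCount s ℕ.+ evenNonzero s
nullity-parity {ℕ.zero}  s = refl
nullity-parity {ℕ.suc N} s with s zero | s zero % 2 | parity-%2 (s zero) | m%n<n (s zero) 2
... | ℕ.zero  | _               | _     | _ = cong ℕ.suc (nullity-parity (s ∘ suc))
... | ℕ.suc k | ℕ.zero          | p%2≡p | _ rewrite sym p%2≡p =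
  trans (cong ℕ.suc (nullity-parity (s ∘ suc))) (sym (ℕ.+-suc _ _))
... | ℕ.suc k | ℕ.suc ℕ.zero    | p%2≡p | _ rewrite sym p%2≡p = nullity-parity (s ∘ suc)
... | ℕ.suc k | ℕ.suc (ℕ.suc _) | _     | s≤s (s≤s ())

fromBool : Bool → Parity
fromBool false = 0ℙ
fromBool true  = 1ℙ

toBool : Parity → Bool
toBool 0ℙ = false
toBool 1ℙ = true

module _ where
  open ℙᴹ

  -- The kernel of diag(d) is parametrised by bit vectors, so that Vec-injective⇒≤ can compare kernels.
  kernelVector : ∀ {N} (d : Vector Parity N) → Vec Bool (nullity d) → Vector Parity N
  kernelVector {ℕ.zero}  d bs = λ ()
  kernelVector {ℕ.suc N} d bs with d zero
  kernelVector {ℕ.suc N} d (b ∷ bs) | 0ℙ = fromBool b ◂ kernelVector (d ∘ suc) bs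
  kernelVector {ℕ.suc N} d bs       | 1ℙ = 0ℙ ◂ kernelVector (d ∘ suc) bs

  kernelCoordinates : ∀ {N} (d : Vector Parity N) → Vector Parity N → Vec Bool (nullity d)
  kernelCoordinates {ℕ.zero}  d x = []
  kernelCoordinates {ℕ.suc N} d x with d zero
  ... | 0ℙ = toBool (x zero) ∷ kernelCoordinates (d ∘ suc) (x ∘ suc)
  ... | 1ℙ = kernelCoordinates (d ∘ suc) (x ∘ suc)

  kernelVector-inKernel : ∀ {N} (d : Vector Parity N) bs → d ⊙ kernelVector d bs ≋ 0ᵛ
  kernelVector-inKernel {ℕ.suc N} d bs i with d zero in d₀
  kernelVector-inKernel {ℕ.suc N} d (b ∷ bs) zero    | 0ℙ = cong (ℙ._* fromBool b) d₀
  kernelVector-inKernel {ℕ.suc N} d (b ∷ bs) (suc i) | 0ℙ = kernelVector-inKernel (d ∘ suc) bs i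
  kernelVector-inKernel {ℕ.suc N} d bs       zero    | 1ℙ = cong (ℙ._* 0ℙ) d₀
  kernelVector-inKernel {ℕ.suc N} d bs       (suc i) | 1ℙ = kernelVector-inKernel (d ∘ suc) bs i

  kernelCoordinates-cong : ∀ {N} (d : Vector Parity N) {x y} → x ≋ y → kernelCoordinates d x ≡ kernelCoordinates d y
  kernelCoordinates-cong {ℕ.zero}  d x≋y = refl
  kernelCoordinates-cong {ℕ.suc N} d x≋y with d zero
  ... | 0ℙ = cong₂ _∷_ (cong toBool (x≋y zero)) (kernelCoordinates-cong (d ∘ suc) (x≋y ∘ suc))
  ... | 1ℙ = kernelCoordinates-cong (d ∘ suc) (x≋y ∘ suc)

  kernelCoordinates-kernelVector : ∀ {N} (d : Vector Parity N) bs → kernelCoordinates d (kernelVector d bs) ≡ bs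
  kernelCoordinates-kernelVector {ℕ.zero}  d [] = refl
  kernelCoordinates-kernelVector {ℕ.suc N} d bs with d zero
  kernelCoordinates-kernelVector {ℕ.suc N} d (b ∷ bs) | 0ℙ =
    cong₂ _∷_ (toBool-fromBool b) (kernelCoordinates-kernelVector (d ∘ suc) bs)
    where
    toBool-fromBool : ∀ b → toBool (fromBool b) ≡ b
    toBool-fromBool false = refl
    toBool-fromBool true  = refl
  kernelCoordinates-kernelVector {ℕ.suc N} d bs | 1ℙ = kernelCoordinates-kernelVector (d ∘ suc) bs

  kernelVector-kernelCoordinates : ∀ {N} (d : Vector Parity N) x → d ⊙ x ≋ 0ᵛ →
                                   kernelVector d (kernelCoordinates d x) ≋ x
  kernelVector-kernelCoordinates {ℕ.suc N} d x dx≋0 i with d zero in d₀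
  kernelVector-kernelCoordinates {ℕ.suc N} d x dx≋0 zero    | 0ℙ = fromBool-toBool (x zero)
    where
    fromBool-toBool : ∀ p → fromBool (toBool p) ≡ p
    fromBool-toBool 0ℙ = refl
    fromBool-toBool 1ℙ = refl
  kernelVector-kernelCoordinates {ℕ.suc N} d x dx≋0 (suc i) | 0ℙ =
    kernelVector-kernelCoordinates (d ∘ suc) (x ∘ suc) (dx≋0 ∘ suc) i
  kernelVector-kernelCoordinates {ℕ.suc N} d x dx≋0 zero    | 1ℙ = sym (trans (sym (cong (ℙ._* x zero) d₀)) (dx≋0 zero))
  kernelVector-kernelCoordinates {ℕ.suc N} d x dx≋0 (suc i) | 1ℙ =
    kernelVector-kernelCoordinates (d ∘ suc) (x ∘ suc) (dx≋0 ∘ suc) i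

  nullity-≤ : ∀ {N} {L : Matrix N} {d d′} → Diagonalisation L d → Diagonalisation L d′ → nullity d ≤ nullity d′
  nullity-≤ {N} {L} {d} {d′} D D′ = Vec-injective⇒≤ f-injective
    where
    module D  = Diagonalisation D
    module D′ = Diagonalisation D′
    open ≡-Reasoning

    T : Vector Parity N → Vector Parity N
    T x = D′.Q⁻¹ · D.Q · x

    T-inKernel : ∀ {x} → d ⊙ x ≋ 0ᵛ → d′ ⊙ T x ≋ 0ᵛ
    T-inKernel = D′.kernel-complete ∘ D.kernel-sound

    T-injective : ∀ {x y} → T x ≋ T y → x ≋ y
    T-injective {x} {y} Tx≋Ty i = begin
      x i                     ≡⟨ D.Q⁻¹·Q x i ⟨
      (D.Q⁻¹ · D.Q · x) i     ≡⟨ ·-cong D.Q⁻¹ (D′.Q·Q⁻¹ (D.Q · x)) i ⟨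
      (D.Q⁻¹ · D′.Q · T x) i  ≡⟨ ·-cong D.Q⁻¹ (·-cong D′.Q Tx≋Ty) i ⟩
      (D.Q⁻¹ · D′.Q · T y) i  ≡⟨ ·-cong D.Q⁻¹ (D′.Q·Q⁻¹ (D.Q · y)) i ⟩
      (D.Q⁻¹ · D.Q · y) i     ≡⟨ D.Q⁻¹·Q y i ⟩
      y i                     ∎

    f : Vec Bool (nullity d) → Vec Bool (nullity d′)
    f bs = kernelCoordinates d′ (T (kernelVector d bs))

    kernelVector-f : ∀ bs → kernelVector d′ (f bs) ≋ T (kernelVector d bs)
    kernelVector-f bs = kernelVector-kernelCoordinates d′ _ (T-inKernel (kernelVector-inKernel d bs))

    f-injective : ∀ {bs cs} → f bs ≡ f cs → bs ≡ cs
    f-injective {bs} {cs} fbs≡fcs = begin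
      bs                                       ≡⟨ kernelCoordinates-kernelVector d bs ⟨
      kernelCoordinates d (kernelVector d bs)  ≡⟨ kernelCoordinates-cong d (T-injective Tbs≋Tcs) ⟩
      kernelCoordinates d (kernelVector d cs)  ≡⟨ kernelCoordinates-kernelVector d cs ⟩
      cs                                       ∎
      where
      Tbs≋Tcs : T (kernelVector d bs) ≋ T (kernelVector d cs)
      Tbs≋Tcs i = trans (sym (kernelVector-f bs i)) (trans (cong (λ v → kernelVector d′ v i) fbs≡fcs) (kernelVector-f cs i))

  nullity-unique : ∀ {N} {L : Matrix N} {d d′} → Diagonalisation L d → Diagonalisation L d′ → nullity d ≡ nullity d′
  nullity-unique D D′ = ℕ.≤-antisym (nullity-≤ D D′) (nullity-≤ D′ D)

-- Zero invariant factors over ℤ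

count-none : ∀ {a p N} {A : Set a} {P : Pred A p} (P? : Decidable P) (f : Fin N → A) →
             (∀ j → ¬ P (f j)) → count P? (tabulate f) ≡ 0
count-none {N = ℕ.zero}  P? f ¬Pf = refl
count-none {N = ℕ.suc N} P? f ¬Pf with P? (f zero)
... | yes Pf₀ = contradiction Pf₀ (¬Pf zero)
... | no  _   = count-none P? (f ∘ suc) (¬Pf ∘ suc)

count-unique : ∀ {a p N} {A : Set a} {P : Pred A p} (P? : Decidable P) (f : Fin N → A) t →
               P (f t) → (∀ j → P (f j) → j ≡ t) → count P? (tabulate f) ≡ 1
count-unique {N = ℕ.suc N} P? f t Pfₜ unique with P? (f zero) | t
... | yes _    | zero  = cong ℕ.suc (count-none P? (f ∘ suc) (λ j Pfⱼ → contradiction (unique (suc j) Pfⱼ) λ ()))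
... | yes Pf₀  | suc t = contradiction (unique zero Pf₀) λ ()
... | no  ¬Pf₀ | zero  = contradiction Pfₜ ¬Pf₀
... | no  _    | suc t = count-unique P? (f ∘ suc) t Pfₜ (λ j Pfⱼ → Finₚ.suc-injective (unique (suc j) Pfⱼ))

module _ {N} {L : ℤᴹ.Matrix N} {s : Fin N → ℕ} (D : ℤᴹ.Diagonalisation L (λ i → + s i)) where
  open ℤᴹ
  open Diagonalisation D
  open ≡-Reasoning

  -- Otherwise Q⁻¹ 1, which lies in the kernel of diag(s), would vanish.
  diagonal-zero-exists : Fin N → L · 1ᵛ ≋ 0ᵛ → ∃ λ t → s t ≡ 0
  diagonal-zero-exists k₀ L1≋0 with Finₚ.any? (λ i → s i ℕ.≟ 0)
  ... | yes ∃zero = ∃zero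
  ... | no  ∄zero = contradiction 1≡0 λ ()
    where
    Q⁻¹1≋0 : Q⁻¹ · 1ᵛ ≋ 0ᵛ
    Q⁻¹1≋0 i with ℤ.i*j≡0⇒i≡0∨j≡0 (+ s i) (kernel-complete L1≋0 i)
    ... | inj₁ sᵢ≡0    = contradiction (i , ℤ.+-injective sᵢ≡0) ∄zero
    ... | inj₂ Q⁻¹1ᵢ≡0 = Q⁻¹1ᵢ≡0
    1≡0 : + 1 ≡ + 0
    1≡0 = begin
      + 1                ≡⟨ Q·Q⁻¹ 1ᵛ k₀ ⟨
      (Q · Q⁻¹ · 1ᵛ) k₀  ≡⟨ ·-cong Q Q⁻¹1≋0 k₀ ⟩
      (Q · 0ᵛ) k₀        ≡⟨ ·-zeroʳ Q k₀ ⟩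
      + 0                ∎

  -- Two zeros sᵢ = sⱼ = 0 make Q eᵢ and Q eⱼ constant, hence proportional, kernel vectors of L.
  diagonal-zero-unique : (∀ x → L · x ≋ 0ᵛ → ∀ j k → x j ≡ x k) → ∀ i j → s i ≡ 0 → s j ≡ 0 → i ≡ j
  diagonal-zero-unique kernel-constant i j sᵢ≡0 sⱼ≡0 with i Data.Fin.≟ j
  ... | yes i≡j = i≡j
  ... | no  i≢j = contradiction 1≡0 λ ()
    where
    e : Fin N → Vector ℤ N
    e t k = idMat t k

    Qe-constant : ∀ t → s t ≡ 0 → ∀ k → (Q · e t) k ≡ (Q · e t) t
    Qe-constant t sₜ≡0 k = kernel-constant (Q · e t) (kernel-sound se≋0) k t
      where
      se≋0 : (λ i → + s i) ⊙ e t ≋ 0ᵛ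
      se≋0 k with k Data.Fin.≟ t
      ... | yes refl = cong (λ n → + n ℤ.* e t t) sₜ≡0
      ... | no  k≢t  = trans (cong (+ s k ℤ.*_) (proj₂ idMat-isIdentity (k≢t ∘ sym))) (ℤ.*-zeroʳ (+ s k))

    cᵢ = (Q · e i) i
    cⱼ = (Q · e j) j

    proportional : (λ k → cⱼ ℤ.* (Q · e i) k) ≋ (λ k → cᵢ ℤ.* (Q · e j) k)
    proportional k rewrite Qe-constant i sᵢ≡0 k | Qe-constant j sⱼ≡0 k = ℤ.*-comm cⱼ cᵢ

    cⱼ≡0 : cⱼ ≡ + 0
    cⱼ≡0 = begin
      cⱼ                                    ≡⟨ ℤ.*-identityʳ cⱼ ⟨
      cⱼ ℤ.* + 1                            ≡⟨ cong (cⱼ ℤ.*_) (trans (sym (proj₁ idMat-isIdentity i)) (sym (Q⁻¹·Q (e i) i))) ⟩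
      cⱼ ℤ.* (Q⁻¹ · Q · e i) i              ≡⟨ ·-*ₗ Q⁻¹ cⱼ (Q · e i) i ⟨
      (Q⁻¹ · (λ k → cⱼ ℤ.* (Q · e i) k)) i  ≡⟨ ·-cong Q⁻¹ proportional i ⟩
      (Q⁻¹ · (λ k → cᵢ ℤ.* (Q · e j) k)) i  ≡⟨ ·-*ₗ Q⁻¹ cᵢ (Q · e j) i ⟩
      cᵢ ℤ.* (Q⁻¹ · Q · e j) i              ≡⟨ cong (cᵢ ℤ.*_) (trans (Q⁻¹·Q (e j) i) (proj₂ idMat-isIdentity (i≢j ∘ sym))) ⟩
      cᵢ ℤ.* + 0                            ≡⟨ ℤ.*-zeroʳ cᵢ ⟩
      + 0                                   ∎

    1≡0 : + 1 ≡ + 0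
    1≡0 = begin
      + 1                ≡⟨ proj₁ idMat-isIdentity j ⟨
      e j j              ≡⟨ Q⁻¹·Q (e j) j ⟨
      (Q⁻¹ · Q · e j) j  ≡⟨ ·-cong Q⁻¹ (λ k → trans (Qe-constant j sⱼ≡0 k) cⱼ≡0) j ⟩
      (Q⁻¹ · 0ᵛ) j       ≡⟨ ·-zeroʳ Q⁻¹ j ⟩
      + 0                ∎

  zeroCount≡1 : Fin N → L · 1ᵛ ≋ 0ᵛ → (∀ x → L · x ≋ 0ᵛ → ∀ j k → x j ≡ x k) → zeroCount s ≡ 1
  zeroCount≡1 k₀ L1≋0 kernel-constant with diagonal-zero-exists k₀ L1≋0
  ... | t , sₜ≡0 = count-unique (ℕ._≟ 0) s t sₜ≡0 (λ j sⱼ≡0 → diagonal-zero-unique kernel-constant j t sⱼ≡0 sₜ≡0)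

-- The Laplacian of G(F₂^r, M)

neighbour : ∀ {r} → V r → Fin (2 ^ r) → Fin (2 ^ r)
neighbour {r} v i = indexOf r (vecOf r i ⊕ v)

neighbour≡⇒⊕≡ : ∀ {r} (v : V r) {i j} → neighbour v i ≡ j → vecOf r i ⊕ v ≡ vecOf r j
neighbour≡⇒⊕≡ {r} v eq = trans (sym (vecOf-indexOf r _)) (cong (vecOf r) eq)

neighbour-≢ : ∀ {r} {v : V r} → Nonzero v → ∀ i → neighbour v i ≢ i
neighbour-≢ {r} {v} v≢0 i eq = v≢0 (begin
  v                            ≡⟨ ⊕-cancelˡ (vecOf r i) v ⟨
  vecOf r i ⊕ (vecOf r i ⊕ v)  ≡⟨ cong (vecOf r i ⊕_) (neighbour≡⇒⊕≡ v eq) ⟩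
  vecOf r i ⊕ vecOf r i        ≡⟨ ⊕-self (vecOf r i) ⟩
  zeroV r                      ∎)
  where open ≡-Reasoning

laplacian-[] : ∀ {r} (i j : Fin (2 ^ r)) → laplacian {r} [] i j ≡ + 0
laplacian-[] i j with i Data.Fin.≟ j
... | yes _ = refl
... | no  _ = refl

laplacian-∷ : ∀ {r n} (v : V r) (M : Vec (V r) n) → Nonzero v → ∀ i j →
              laplacian (v ∷ M) i j ≡ (idMat i j ℤ.- idMat (neighbour v i) j) ℤ.+ laplacian M i j
laplacian-∷ {r} {n} v M v≢0 i j with i Data.Fin.≟ j
... | yes refl = cong (λ δ → (+ 1 ℤ.- δ) ℤ.+ + n) (sym (proj₂ idMat-isIdentity (neighbour-≢ v≢0 i)))
... | no  i≢j with (vecOf r i ⊕ v) ≟V vecOf r j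
...   | yes i⊕v≡j = trans (ℤ.neg-distrib-+ (+ 1) (+ edges M (vecOf r i) (vecOf r j)))
                          (cong (λ δ → (+ 0 ℤ.- δ) ℤ.+ ℤ.- + edges M (vecOf r i) (vecOf r j)) (sym δ≡1))
  where
  δ≡1 : idMat (neighbour v i) j ≡ + 1
  δ≡1 = trans (cong (λ k → idMat k j) (trans (cong (indexOf r) i⊕v≡j) (indexOf-vecOf r j))) (proj₁ idMat-isIdentity j)
...   | no  i⊕v≢j = trans (sym (ℤ.+-identityˡ _))
                          (cong (λ δ → (+ 0 ℤ.- δ) ℤ.+ ℤ.- + edges M (vecOf r i) (vecOf r j))
                                (sym (proj₂ idMat-isIdentity (i⊕v≢j ∘ neighbour≡⇒⊕≡ v))))

edges≡mult : ∀ {r n} (M : Vec (V r) n) a b → edges M a b ≡ mult (a ⊕ b) M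
edges≡mult []      a b = refl
edges≡mult (v ∷ M) a b with (a ⊕ v) ≟V b | (a ⊕ b) ≟V v
... | yes _     | yes _     = cong ℕ.suc (edges≡mult M a b)
... | no  _     | no  _     = edges≡mult M a b
... | yes a⊕v≡b | no  a⊕b≢v = contradiction (trans (cong (a ⊕_) (sym a⊕v≡b)) (⊕-cancelˡ a v)) a⊕b≢v
... | no  a⊕v≢b | yes a⊕b≡v = contradiction (trans (cong (a ⊕_) (sym a⊕b≡v)) (⊕-cancelˡ a b)) a⊕v≢b

laplacian-offDiagonal : ∀ {r n} (M : Vec (V r) n) {i j} → i ≢ j →
                        laplacian M i j ≡ ℤ.- + mult (vecOf r i ⊕ vecOf r j) M
laplacian-offDiagonal {r} M {i} {j} i≢j with i Data.Fin.≟ j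
... | yes i≡j = contradiction i≡j i≢j
... | no  _   = cong (λ e → ℤ.- + e) (edges≡mult M (vecOf r i) (vecOf r j))

vecOf-⊕-nonzero : ∀ r {i j} → i ≢ j → Nonzero (vecOf r i ⊕ vecOf r j)
vecOf-⊕-nonzero r {i} {j} i≢j i⊕j≡0 = i≢j (vecOf-injective r (begin
  vecOf r i                            ≡⟨ ⊕-identityʳ (vecOf r i) ⟨
  vecOf r i ⊕ zeroV r                  ≡⟨ cong (vecOf r i ⊕_) i⊕j≡0 ⟨
  vecOf r i ⊕ (vecOf r i ⊕ vecOf r j)  ≡⟨ ⊕-cancelˡ (vecOf r i) (vecOf r j) ⟩
  vecOf r j                            ∎))
  where open ≡-Reasoning

linComb-closed : ∀ {r n} (M : Vec (V r) n) (S : V r → Set) → (∀ w k → S w → S (w ⊕ lookup M k)) →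
                 ∀ c w → S w → S (w ⊕ linComb M c)
linComb-closed []      S step []          w Sw = subst S (sym (⊕-identityʳ w)) Sw
linComb-closed (v ∷ M) S step (true ∷ c)  w Sw =
  subst S (⊕-assoc w v (linComb M c)) (linComb-closed M S (λ w k → step w (suc k)) c (w ⊕ v) (step w zero Sw))
linComb-closed (v ∷ M) S step (false ∷ c) w Sw =
  subst S (⊕-assoc w (zeroV _) (linComb M c))
    (linComb-closed M S (λ w k → step w (suc k)) c (w ⊕ zeroV _) (subst S (sym (⊕-identityʳ w)) Sw))

module _ where
  open ℤᴹ

  laplacian-· : ∀ {r n} (M : Vec (V r) n) → All Nonzero M → ∀ x i →
                (laplacian M · x) i ≡ ∑[ k < n ] (x i ℤ.- x (neighbour (lookup M k) i))
  laplacian-· {r} [] [] x i = ∑-zero (λ j → laplacian {r} [] i j ℤ.* x j)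
    (λ j → trans (cong (ℤ._* x j) (laplacian-[] {r} i j)) (ℤ.*-zeroˡ (x j)))
  laplacian-· {n = ℕ.suc n} (v ∷ M) (v≢0 ∷ nz) x i = begin
    (laplacian (v ∷ M) · x) i
      ≡⟨ ·-congˡ (laplacian-∷ v M v≢0) x i ⟩
    ((λ i j → (idMat i j ℤ.- T i j) ℤ.+ laplacian M i j) · x) i
      ≡⟨ ·-distribʳ-+ (λ i j → idMat i j ℤ.- T i j) (laplacian M) x i ⟩
    ((λ i j → idMat i j ℤ.- T i j) · x) i ℤ.+ (laplacian M · x) i
      ≡⟨ cong (ℤ._+ (laplacian M · x) i) (·-distribʳ-+ idMat (λ i j → ℤ.- T i j) x i) ⟩
    ((idMat · x) i ℤ.+ ((λ i j → ℤ.- T i j) · x) i) ℤ.+ (laplacian M · x) i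
      ≡⟨ cong₂ ℤ._+_ (cong₂ ℤ._+_ (·-identity idMat-isIdentity x i) (·-neg T x i)) (laplacian-· M nz x i) ⟩
    (x i ℤ.- (T · x) i) ℤ.+ ∑[ k < n ] (x i ℤ.- x (neighbour (lookup M k) i))
      ≡⟨ cong (λ y → (x i ℤ.- y) ℤ.+ _) (·-identity idMat-isIdentity x (neighbour v i)) ⟩
    (x i ℤ.- x (neighbour v i)) ℤ.+ ∑[ k < n ] (x i ℤ.- x (neighbour (lookup M k) i))
      ∎
    where
    open ≡-Reasoning
    T : Matrix _
    T i j = idMat (neighbour v i) j

  laplacian-·-1ᵛ : ∀ {r n} (M : Vec (V r) n) → All Nonzero M → laplacian M · 1ᵛ ≋ 0ᵛ
  laplacian-·-1ᵛ {n = n} M nz i = trans (laplacian-· M nz 1ᵛ i) (∑-zero {n} (λ _ → + 1 ℤ.- + 1) (λ _ → refl))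

  +-nonneg≡0 : ∀ {a b} → + 0 ℤ.≤ a → + 0 ℤ.≤ b → a ℤ.+ b ≡ + 0 → a ≡ + 0 × b ≡ + 0
  +-nonneg≡0 {a} {b} 0≤a 0≤b a+b≡0 = a≡0 , trans (sym (ℤ.+-identityˡ b)) (trans (cong (ℤ._+ b) (sym a≡0)) a+b≡0)
    where
    a≡0 : a ≡ + 0
    a≡0 = ℤ.≤-antisym (begin
      a           ≡⟨ ℤ.+-identityʳ a ⟨
      a ℤ.+ + 0   ≤⟨ ℤ.+-monoʳ-≤ a 0≤b ⟩
      a ℤ.+ b     ≡⟨ a+b≡0 ⟩
      + 0         ∎) 0≤a
      where open ℤ.≤-Reasoning

  ∑-nonneg : ∀ {n} (f : Vector ℤ n) → (∀ k → + 0 ℤ.≤ f k) → + 0 ℤ.≤ ∑[ k < n ] f k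
  ∑-nonneg {ℕ.zero}  f f≥0 = ℤ.≤-refl
  ∑-nonneg {ℕ.suc n} f f≥0 = ℤ.+-mono-≤ (f≥0 zero) (∑-nonneg (f ∘ suc) (f≥0 ∘ suc))

  ∑-nonneg≡0 : ∀ {n} (f : Vector ℤ n) → (∀ k → + 0 ℤ.≤ f k) → ∑[ k < n ] f k ≡ + 0 → ∀ k → f k ≡ + 0
  ∑-nonneg≡0 {ℕ.suc n} f f≥0 ∑f≡0 k
    with +-nonneg≡0 (f≥0 zero) (∑-nonneg (f ∘ suc) (f≥0 ∘ suc)) ∑f≡0 | k
  ... | f₀≡0 , _      | zero   = f₀≡0
  ... | _    , rest≡0 | suc k′ = ∑-nonneg≡0 (f ∘ suc) (f≥0 ∘ suc) rest≡0 k′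

  -- Maximum principle: at a maximum of x the equation (L x)ᵢ = 0 forces every neighbour to be
  -- a maximum too, and the neighbour relation connects everything because M generates F₂^r.
  laplacian-kernel-constant : ∀ {r n} (M : Vec (V r) n) → All Nonzero M → Generates M →
                              ∀ x → laplacian M · x ≋ 0ᵛ → ∀ j k → x j ≡ x k
  laplacian-kernel-constant {r} M nz generates x Lx≋0 j k = trans (x≡max j) (sym (x≡max k))
    where
    open ≡-Reasoning
    i₀ = argmax x (indexOf r (zeroV r)) (allFin (2 ^ r))

    x≤max : ∀ j → x j ℤ.≤ x i₀
    x≤max j = ListAll.lookup (f[xs]≤f[argmax] (indexOf r (zeroV r)) (allFin (2 ^ r))) (∈-allFin j)

    AtMax : V r → Set
    AtMax w = x (indexOf r w) ≡ x i₀

    step : ∀ w k → AtMax w → AtMax (w ⊕ lookup M k)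
    step w k xᵢ≡max = begin
      x (indexOf r (w ⊕ lookup M k))  ≡⟨ cong (λ u → x (indexOf r (u ⊕ lookup M k))) (vecOf-indexOf r w) ⟨
      x (neighbour (lookup M k) i)    ≡⟨ ℤ.i-j≡0⇒i≡j _ _ (differences≡0 k) ⟨
      x i                             ≡⟨ xᵢ≡max ⟩
      x i₀                            ∎
      where
      i = indexOf r w
      differences≡0 : ∀ k → x i ℤ.- x (neighbour (lookup M k) i) ≡ + 0
      differences≡0 = ∑-nonneg≡0 _
        (λ k → ℤ.i≤j⇒0≤j-i (subst (x (neighbour (lookup M k) i) ℤ.≤_) (sym xᵢ≡max) (x≤max _)))
        (trans (sym (laplacian-· M nz x i)) (Lx≋0 i))

    x≡max : ∀ j → x j ≡ x i₀
    x≡max j with generates (vecOf r i₀ ⊕ vecOf r j)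
    ... | c , c↦i₀⊕j = begin
      x j                          ≡⟨ cong x (indexOf-vecOf r j) ⟨
      x (indexOf r (vecOf r j))
        ≡⟨ subst AtMax reaches-j (linComb-closed M AtMax step c (vecOf r i₀) (cong x (indexOf-vecOf r i₀))) ⟩
      x i₀                         ∎
      where
      reaches-j : vecOf r i₀ ⊕ linComb M c ≡ vecOf r j
      reaches-j = trans (cong (vecOf r i₀ ⊕_) c↦i₀⊕j) (⊕-cancelˡ (vecOf r i₀) (vecOf r j))

laplacian-parity : ∀ {r n n′} (M : Vec (V r) n) (M′ : Vec (V r) n′) → All Nonzero M → All Nonzero M′ →
                   (∀ u → Nonzero u → mult u M % 2 ≡ mult u M′ % 2) →
                   ∀ i j → parityᴹ (laplacian M) i j ≡ parityᴹ (laplacian M′) i j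
laplacian-parity {r} M M′ nz nz′ ≡mod2 =
  ℙᴹ.offDiagonal-determines (parityᴹ (laplacian M)) (parityᴹ (laplacian M′)) (rowSums M nz) (rowSums M′ nz′) offDiagonal
  where
  rowSums : ∀ {n} (M : Vec (V r) n) → All Nonzero M → parityᴹ (laplacian M) ℙᴹ.· ℙᴹ.1ᵛ ℙᴹ.≋ ℙᴹ.0ᵛ
  rowSums M nz i = trans (sym (parityℤ-· (laplacian M) ℤᴹ.1ᵛ i)) (cong parityℤ (laplacian-·-1ᵛ M nz i))
  offDiagonal : ∀ {i j} → i ≢ j → parityᴹ (laplacian M) i j ≡ parityᴹ (laplacian M′) i j
  offDiagonal {i} {j} i≢j = begin
    parityℤ (laplacian M i j)   ≡⟨ cong parityℤ (laplacian-offDiagonal M i≢j) ⟩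
    parityℤ (ℤ.- + mult u M)    ≡⟨ parityℤ-neg (+ mult u M) ⟩
    parity (mult u M)           ≡⟨ parity-%2 (mult u M) ⟨
    parity (mult u M % 2)       ≡⟨ cong parity (≡mod2 u (vecOf-⊕-nonzero r i≢j)) ⟩
    parity (mult u M′ % 2)      ≡⟨ parity-%2 (mult u M′) ⟩
    parity (mult u M′)          ≡⟨ parityℤ-neg (+ mult u M′) ⟨
    parityℤ (ℤ.- + mult u M′)   ≡⟨ cong parityℤ (laplacian-offDiagonal M′ i≢j) ⟨
    parityℤ (laplacian M′ i j)  ∎
    where
    open ≡-Reasoning
    u = vecOf r i ⊕ vecOf r j

smithForm-laplacian-zeroCount : ∀ {r n} (M : Vec (V r) n) → All Nonzero M → Generates M →
                                (S : SmithForm (laplacian M)) → zeroCount (SmithForm.s S) ≡ 1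
smithForm-laplacian-zeroCount {r} M nz generates S =
  zeroCount≡1 (overℤ S) (indexOf r (zeroV r)) (laplacian-·-1ᵛ M nz) (laplacian-kernel-constant M nz generates)

mainTheorem2 : (r n n′ : ℕ) (M : Vec (V r) n) (M′ : Vec (V r) n′) →
    All Nonzero M → All Nonzero M′ →
    Generates M → Generates M′ →
    (∀ (u : V r) → Nonzero u → mult u M % 2 ≡ mult u M′ % 2) →
    (S : SmithForm (laplacian M)) (S′ : SmithForm (laplacian M′)) →
    dOf S ≡ dOf S′
mainTheorem2 r n n′ M M′ nz nz′ generates generates′ ≡mod2 S S′ = ℕ.suc-injective (begin
  ℕ.suc (dOf S)                  ≡⟨ cong (ℕ._+ dOf S) (smithForm-laplacian-zeroCount M nz generates S) ⟨
  zeroCount s ℕ.+ dOf S          ≡⟨ nullity-parity s ⟨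
  nullity (λ i → parity (s i))   ≡⟨ nullity-unique (overℙ S) (ℙᴹ.Diagonalisation-resp L′≡L (overℙ S′)) ⟩
  nullity (λ i → parity (s′ i))  ≡⟨ nullity-parity s′ ⟩
  zeroCount s′ ℕ.+ dOf S′        ≡⟨ cong (ℕ._+ dOf S′) (smithForm-laplacian-zeroCount M′ nz′ generates′ S′) ⟩
  ℕ.suc (dOf S′)                 ∎)
  where
  open ≡-Reasoning
  s = SmithForm.s S
  s′ = SmithForm.s S′
  L′≡L : ∀ i j → parityᴹ (laplacian M′) i j ≡ parityᴹ (laplacian M) i j
  L′≡L i j = sym (laplacian-parity M M′ nz nz′ ≡mod2 i j)
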